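{- For every duplicative forest $\mathfrak{f}$, the poset $\mathcal{D}^*(\mathfrak{f}) = \{\mathfrak{f}' : \mathfrak{f}\ll\mathfrak{f}'\}$ is a lattice, and for all $\mathfrak{f}',\mathfrak{f}''\in\mathcal{D}^*(\mathfrak{f})$ the forests $\mathfrak{f}'\wedge\mathfrak{f}''$ and $\mathfrak{f}'\vee\mathfrak{f}''$ are well defined and are respectively the meet and the join of $\mathfrak{f}'$ and $\mathfrak{f}''$ in $\mathcal{D}^*(\mathfrak{f})$.
   Context: A duplicative forest is a finite word of duplicative trees (empty word $\epsilon$ allowed); a duplicative tree is $\circ(\mathfrak{g})$ or $\bullet(\mathfrak{g})$ with $\mathfrak{g}$ a duplicative forest (a planar rooted tree with white/black nodes). Concatenation is $\cdot$. $\mathfrak{f}\lessdot\mathfrak{f}'$ iff $\mathfrak{f}'$ is obtained from $\mathfrak{f}$ by replacing one subtree $\circ(\mathfrak{g})$ by $\bullet(\mathfrak{g}\cdot\mathfrak{g})$; $\ll$ is its reflexive transitive closure (a partial order). The partial binary operations $\wedge,\vee$ (commutative) are defined recursively: for trees $\mathfrak{f}_i,\mathfrak{f}'_i$, $(\mathfrak{f}_1\cdots\mathfrak{f}_\ell)\wedge(\mathfrak{f}'_1\cdots\mathfrak{f}'_\ell) := (\mathfrak{f}_1\wedge\mathfrak{f}'_1)\cdots(\mathfrak{f}_\ell\wedge\mathfrak{f}'_\ell)$; $\circ(\mathfrak{f})\wedge\circ(\mathfrak{f}') := \circ(\mathfrak{f}\wedge\mathfrak{f}')$; $\bullet(\mathfrak{f})\wedge\bullet(\mathfrak{f}')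 := \bullet(\mathfrak{f}\wedge\mathfrak{f}')$; $\circ(\mathfrak{f})\wedge\bullet(\mathfrak{f}'\cdot\mathfrak{f}'') := \circ(\mathfrak{f}\wedge\mathfrak{f}'\wedge\mathfrak{f}'')$ (with $\mathfrak{f}',\mathfrak{f}''$ of the same length as $\mathfrak{f}$). Similarly $(\mathfrak{f}_1\cdots\mathfrak{f}_\ell)\vee(\mathfrak{f}'_1\cdots\mathfrak{f}'_\ell) := (\mathfrak{f}_1\vee\mathfrak{f}'_1)\cdots(\mathfrak{f}_\ell\vee\mathfrak{f}'_\ell)$; $\circ(\mathfrak{f})\vee\circ(\mathfrak{f}') := \circ(\mathfrak{f}\vee\mathfrak{f}')$; $\bullet(\mathfrak{f})\vee\bullet(\mathfrak{f}') := \bullet(\mathfrak{f}\vee\mathfrak{f}')$; $\circ(\mathfrak{f})\vee\bullet(\mathfrak{f}'\cdot\mathfrak{f}'') := \bullet((\mathfrak{f}\vee\mathfrak{f}')\cdot(\mathfrak{f}\vee\mathfrak{f}''))$. -}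

module Defs where

open import Data.List using (List; []; _∷_; _++_; length)
open import Data.Product using (_×_)
open import Relation.Binary.PropositionalEquality using (_≡_)
open import Relation.Binary.Construct.Closure.ReflexiveTransitive using (Star)

data Tree : Set where
  white : List Tree → Tree
  black : List Tree → Tree

Forest : Set
Forest = List Tree

mutual
  data _⋖T_ : Tree → Tree → Set where
    dup : ∀ {g} → white g ⋖T black (g ++ g)
    inW : ∀ {g g'} → g ⋖F g' → white g ⋖T white g'
    inB : ∀ {g g'} → g ⋖F g' → black g ⋖T black g'

  data _⋖F_ : Forest → Forest → Set where
    hd : ∀ {t t' r} → t ⋖T t' → (t ∷ r) ⋖F (t' ∷ r)
    tl : ∀ {t r r'} → r ⋖F r' → (t ∷ r) ⋖F (t ∷ r')

_≪_ : Forest → Forest → Set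
_≪_ = Star _⋖F_

-- Graph of the partial operation ∧ : MeetF a b c means "a ∧ b is defined and equals c".
-- f ∧ f' ∧ f'' is read as (f ∧ f') ∧ f''.
mutual
  data MeetT : Tree → Tree → Tree → Set where
    ww : ∀ {f f' h} → MeetF f f' h → MeetT (white f) (white f') (white h)
    bb : ∀ {f f' h} → MeetF f f' h → MeetT (black f) (black f') (black h)
    wb : ∀ {f f' f'' x h} → length f' ≡ length f → length f'' ≡ length f →
         MeetF f f' x → MeetF x f'' h →
         MeetT (white f) (black (f' ++ f'')) (white h)
    bw : ∀ {f f' f'' x h} → length f' ≡ length f → length f'' ≡ length f →
         MeetF f f' x → MeetF x f'' h →
         MeetT (black (f' ++ f'')) (white f) (white h)

  data MeetF : Forest → Forest → Forest → Set where
    nil  : MeetF [] [] []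
    cons : ∀ {t t' u r r' s} → MeetT t t' u → MeetF r r' s →
           MeetF (t ∷ r) (t' ∷ r') (u ∷ s)

mutual
  data JoinT : Tree → Tree → Tree → Set where
    ww : ∀ {f f' h} → JoinF f f' h → JoinT (white f) (white f') (white h)
    bb : ∀ {f f' h} → JoinF f f' h → JoinT (black f) (black f') (black h)
    wb : ∀ {f f' f'' h₁ h₂} → length f' ≡ length f → length f'' ≡ length f →
         JoinF f f' h₁ → JoinF f f'' h₂ →
         JoinT (white f) (black (f' ++ f'')) (black (h₁ ++ h₂))
    bw : ∀ {f f' f'' h₁ h₂} → length f' ≡ length f → length f'' ≡ length f →
         JoinF f f' h₁ → JoinF f f'' h₂ →
         JoinT (black (f' ++ f'')) (white f) (black (h₁ ++ h₂))

  data JoinF : Forest → Forest → Forest → Set where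
    nil  : JoinF [] [] []
    cons : ∀ {t t' u r r' s} → JoinT t t' u → JoinF r r' s →
           JoinF (t ∷ r) (t' ∷ r') (u ∷ s)

IsMeetIn : Forest → Forest → Forest → Forest → Set
IsMeetIn f a b m =
  f ≪ m × m ≪ a × m ≪ b × (∀ g → f ≪ g → g ≪ a → g ≪ b → g ≪ m)

IsJoinIn : Forest → Forest → Forest → Forest → Set
IsJoinIn f a b j =
  f ≪ j × a ≪ j × b ≪ j × (∀ g → f ≪ g → a ≪ g → b ≪ g → j ≪ g)

{-# OPTIONS --safe #-}
module Submission where

-- ≪ has a structural description: trees are compared node by node, except that ∘(g)
-- lies below •(h) exactly when g · g lies below h, i.e. when the two halves of h refine
-- g independently (later rewrites inside the two copies do not interact). In this
-- order ∧ and ∨ are computed by the recursion defining them. At a mixed node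
-- ∘(f) against •(f' · f''), a common lower bound must be white and lie below f, f' and
-- f'', so the meet is ∘(f ∧ f' ∧ f''); a common upper bound must be black and lie above
-- f · f and f' · f'', so the join is •((f ∨ f') · (f ∨ f'')).

open import Defs
open import Data.List using ([]; _∷_; _++_; length)
open import Data.List.Relation.Binary.Pointwise using (Pointwise; []; _∷_; Pointwise-length; ++⁺)
open import Data.Nat.Properties using (suc-injective)
open import Data.Product using (_×_; ∃; ∃₂; _,_; proj₁; map₂)
open import Relation.Binary.Core using (REL)
open import Relation.Binary.PropositionalEquality using (_≡_; refl; sym; trans)
open import Relation.Binary.Construct.Closure.ReflexiveTransitive using (Star; ε; _◅_; _◅◅_; gmap)

module _ {a b ℓ} {A : Set a} {B : Set b} {R : REL A B ℓ} where

  same-length-above : ∀ {xs ys zs} → Pointwise R xs ys → Pointwise R xs zs → length ys ≡ length zs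
  same-length-above p q = trans (sym (Pointwise-length p)) (Pointwise-length q)

  Pointwise-++⁻ : ∀ xs ys {zs} → Pointwise R (xs ++ ys) zs →
    ∃₂ λ zs₁ zs₂ → zs ≡ zs₁ ++ zs₂ × Pointwise R xs zs₁ × Pointwise R ys zs₂
  Pointwise-++⁻ []       ys rs       = [] , _ , refl , [] , rs
  Pointwise-++⁻ (x ∷ xs) ys (r ∷ rs) with Pointwise-++⁻ xs ys rs
  ... | zs₁ , zs₂ , refl , rs₁ , rs₂ = _ ∷ zs₁ , zs₂ , refl , r ∷ rs₁ , rs₂

  Pointwise-++⁻-length : ∀ ws {xs ys zs} → length ws ≡ length ys →
    Pointwise R (ws ++ xs) (ys ++ zs) → Pointwise R ws ys × Pointwise R xs zs
  Pointwise-++⁻-length []       {ys = []}    _ rs       = [] , rs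
  Pointwise-++⁻-length (w ∷ ws) {ys = y ∷ ys} l (r ∷ rs) =
    let rs₁ , rs₂ = Pointwise-++⁻-length ws (suc-injective l) rs in r ∷ rs₁ , rs₂

module _ {A : Set} (_≤_ : A → A → Set) where

  IsMeetAbove : A → A → A → A → Set
  IsMeetAbove t a b m = t ≤ m × m ≤ a × m ≤ b × (∀ c → t ≤ c → c ≤ a → c ≤ b → c ≤ m)

  IsJoin : A → A → A → Set
  IsJoin a b j = a ≤ j × b ≤ j × (∀ c → a ≤ c → b ≤ c → j ≤ c)

  IsMeetAbove-sym : ∀ {t a b m} → IsMeetAbove t a b m → IsMeetAbove t b a m
  IsMeetAbove-sym (t≤m , m≤a , m≤b , greatest) =
    t≤m , m≤b , m≤a , λ c t≤c c≤b c≤a → greatest c t≤c c≤a c≤b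

  IsJoin-sym : ∀ {a b j} → IsJoin a b j → IsJoin b a j
  IsJoin-sym (a≤j , b≤j , least) = b≤j , a≤j , λ c b≤c a≤c → least c a≤c b≤c

module _ {A : Set} {_≤_ : A → A → Set} where

  IsMeetAbove-[] : IsMeetAbove (Pointwise _≤_) [] [] [] []
  IsMeetAbove-[] = [] , [] , [] , λ { [] [] [] [] → [] }

  IsMeetAbove-∷ : ∀ {t a b m t' a' b' m'} →
    IsMeetAbove _≤_ t a b m → IsMeetAbove (Pointwise _≤_) t' a' b' m' →
    IsMeetAbove (Pointwise _≤_) (t ∷ t') (a ∷ a') (b ∷ b') (m ∷ m')
  IsMeetAbove-∷ (t≤m , m≤a , m≤b , greatest) (t'≤m' , m'≤a' , m'≤b' , greatest') =
    t≤m ∷ t'≤m' , m≤a ∷ m'≤a' , m≤b ∷ m'≤b' ,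
    λ { (c ∷ c') (t≤c ∷ t'≤c') (c≤a ∷ c'≤a') (c≤b ∷ c'≤b') →
          greatest c t≤c c≤a c≤b ∷ greatest' c' t'≤c' c'≤a' c'≤b' }

  IsJoin-[] : IsJoin (Pointwise _≤_) [] [] []
  IsJoin-[] = [] , [] , λ { [] [] [] → [] }

  IsJoin-∷ : ∀ {a b j a' b' j'} → IsJoin _≤_ a b j → IsJoin (Pointwise _≤_) a' b' j' →
    IsJoin (Pointwise _≤_) (a ∷ a') (b ∷ b') (j ∷ j')
  IsJoin-∷ (a≤j , b≤j , least) (a'≤j' , b'≤j' , least') =
    a≤j ∷ a'≤j' , b≤j ∷ b'≤j' ,
    λ { (c ∷ c') (a≤c ∷ a'≤c') (b≤c ∷ b'≤c') → least c a≤c b≤c ∷ least' c' a'≤c' b'≤c' }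

  IsJoin-++ : ∀ {a b j a' b' j'} →
    IsJoin (Pointwise _≤_) a b j → IsJoin (Pointwise _≤_) a' b' j' →
    IsJoin (Pointwise _≤_) (a ++ a') (b ++ b') (j ++ j')
  IsJoin-++ {a} {b} {a' = a'} {b'} (a≤j , b≤j , least) (a'≤j' , b'≤j' , least') =
    ++⁺ a≤j a'≤j' , ++⁺ b≤j b'≤j' , least″
    where
    least″ : ∀ c → Pointwise _≤_ (a ++ a') c → Pointwise _≤_ (b ++ b') c → Pointwise _≤_ _ c
    least″ c aa'≤c bb'≤c with Pointwise-++⁻ a a' aa'≤c
    ... | c₁ , _ , refl , a≤c₁ , a'≤c₂ =
      let b≤c₁ , b'≤c₂ = Pointwise-++⁻-length b
                           (trans (Pointwise-length b≤j) (same-length-above a≤j a≤c₁)) bb'≤c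
      in ++⁺ (least c₁ a≤c₁ b≤c₁) (least' _ a'≤c₂ b'≤c₂)

infix 4 _≤T_ _≤F_

mutual
  data _≤T_ : Tree → Tree → Set where
    white≤white : ∀ {g h} → g ≤F h → white g ≤T white h
    black≤black : ∀ {g h} → g ≤F h → black g ≤T black h
    white≤black : ∀ {g h₁ h₂} → g ≤F h₁ → g ≤F h₂ → white g ≤T black (h₁ ++ h₂)

  _≤F_ : Forest → Forest → Set
  _≤F_ = Pointwise _≤T_

++≤F⇒white≤black : ∀ g {h} → g ++ g ≤F h → white g ≤T black h
++≤F⇒white≤black g p with Pointwise-++⁻ g g p
... | _ , _ , refl , p₁ , p₂ = white≤black p₁ p₂

white≤black⇒++≤F : ∀ {g h} → white g ≤T black h → g ++ g ≤F h
white≤black⇒++≤F (white≤black p₁ p₂) = ++⁺ p₁ p₂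

mutual
  ≤T-refl : ∀ t → t ≤T t
  ≤T-refl (white g) = white≤white (≤F-refl g)
  ≤T-refl (black g) = black≤black (≤F-refl g)

  ≤F-refl : ∀ f → f ≤F f
  ≤F-refl []      = []
  ≤F-refl (t ∷ f) = ≤T-refl t ∷ ≤F-refl f

mutual
  ≤T-trans : ∀ {s t u} → s ≤T t → t ≤T u → s ≤T u
  ≤T-trans (white≤white p)     (white≤white q)     = white≤white (≤F-trans p q)
  ≤T-trans (white≤white p)     (white≤black q₁ q₂) = white≤black (≤F-trans p q₁) (≤F-trans p q₂)
  ≤T-trans (black≤black p)     (black≤black q)     = black≤black (≤F-trans p q)
  ≤T-trans (white≤black p₁ p₂) (black≤black q)     = ++≤F⇒white≤black _ (≤F-trans (++⁺ p₁ p₂) q)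

  ≤F-trans : ∀ {f g h} → f ≤F g → g ≤F h → f ≤F h
  ≤F-trans []       []       = []
  ≤F-trans (p ∷ ps) (q ∷ qs) = ≤T-trans p q ∷ ≤F-trans ps qs

mutual
  ⋖T⇒≤T : ∀ {s t} → s ⋖T t → s ≤T t
  ⋖T⇒≤T (dup {g}) = white≤black (≤F-refl g) (≤F-refl g)
  ⋖T⇒≤T (inW p)   = white≤white (⋖F⇒≤F p)
  ⋖T⇒≤T (inB p)   = black≤black (⋖F⇒≤F p)

  ⋖F⇒≤F : ∀ {f g} → f ⋖F g → f ≤F g
  ⋖F⇒≤F (hd {r = r} p) = ⋖T⇒≤T p ∷ ≤F-refl r
  ⋖F⇒≤F (tl {t = t} p) = ≤T-refl t ∷ ⋖F⇒≤F p

≪⇒≤F : ∀ {f g} → f ≪ g → f ≤F g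
≪⇒≤F {f} ε   = ≤F-refl f
≪⇒≤F (s ◅ p) = ≤F-trans (⋖F⇒≤F s) (≪⇒≤F p)

⋖F-++ˡ : ∀ {f f'} g → f ⋖F f' → (f ++ g) ⋖F (f' ++ g)
⋖F-++ˡ g (hd p) = hd p
⋖F-++ˡ g (tl p) = tl (⋖F-++ˡ g p)

⋖F-++ʳ : ∀ f {g g'} → g ⋖F g' → (f ++ g) ⋖F (f ++ g')
⋖F-++ʳ []      p = p
⋖F-++ʳ (t ∷ f) p = tl (⋖F-++ʳ f p)

≪-++ : ∀ {f f' g g'} → f ≪ f' → g ≪ g' → (f ++ g) ≪ (f' ++ g')
≪-++ {f' = f'} {g} p q = gmap (_++ g) (⋖F-++ˡ g) p ◅◅ gmap (f' ++_) (⋖F-++ʳ f') q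

mutual
  ≤T⇒≪T : ∀ {s t} → s ≤T t → Star _⋖T_ s t
  ≤T⇒≪T (white≤white p)     = gmap white inW (≤F⇒≪ p)
  ≤T⇒≪T (black≤black p)     = gmap black inB (≤F⇒≪ p)
  ≤T⇒≪T (white≤black p₁ p₂) = dup ◅ gmap black inB (≪-++ (≤F⇒≪ p₁) (≤F⇒≪ p₂))

  ≤F⇒≪ : ∀ {f g} → f ≤F g → f ≪ g
  ≤F⇒≪ []                        = ε
  ≤F⇒≪ {_ ∷ r} {t' ∷ _} (p ∷ ps) = gmap (_∷ r) hd (≤T⇒≪T p) ◅◅ gmap (t' ∷_) tl (≤F⇒≪ ps)

MeetF-++ : ∀ {a b m a' b' m'} → MeetF a b m → MeetF a' b' m' → MeetF (a ++ a') (b ++ b') (m ++ m')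
MeetF-++ nil         M' = M'
MeetF-++ (cons M Ms) M' = cons M (MeetF-++ Ms M')

-- The bound t ≤T m is part of the result because the nested meet (f ∧ f') ∧ f'' needs it.
mutual
  meetT-exists : ∀ t {a b} → t ≤T a → t ≤T b → ∃ λ m → MeetT a b m × t ≤T m
  meetT-exists (white g) (white≤white p) (white≤white q) =
    let h , M , g≤h = meetF-exists g p q in white h , ww M , white≤white g≤h
  meetT-exists (white g) (white≤white p) (white≤black q₁ q₂) =
    let _ , h , M₁ , M₂ , g≤h = wb-meet-exists g p q₁ q₂
    in white h , wb (same-length-above q₁ p) (same-length-above q₂ p) M₁ M₂ , white≤white g≤h
  meetT-exists (white g) (white≤black q₁ q₂) (white≤white p) =
    let _ , h , M₁ , M₂ , g≤h = wb-meet-exists g p q₁ q₂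
    in white h , bw (same-length-above q₁ p) (same-length-above q₂ p) M₁ M₂ , white≤white g≤h
  meetT-exists (white g) (white≤black p₁ p₂) (white≤black q₁ q₂) =
    let h₁ , M₁ , g≤h₁ = meetF-exists g p₁ q₁
        h₂ , M₂ , g≤h₂ = meetF-exists g p₂ q₂
    in black (h₁ ++ h₂) , bb (MeetF-++ M₁ M₂) , white≤black g≤h₁ g≤h₂
  meetT-exists (black g) (black≤black p) (black≤black q) =
    let h , M , g≤h = meetF-exists g p q in black h , bb M , black≤black g≤h

  wb-meet-exists : ∀ g {f f' f''} → g ≤F f → g ≤F f' → g ≤F f'' →
    ∃₂ λ x h → MeetF f f' x × MeetF x f'' h × g ≤F h
  wb-meet-exists g p q₁ q₂ =
    let x , M₁ , g≤x = meetF-exists g p q₁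
        h , M₂ , g≤h = meetF-exists g g≤x q₂
    in x , h , M₁ , M₂ , g≤h

  meetF-exists : ∀ f {a b} → f ≤F a → f ≤F b → ∃ λ m → MeetF a b m × f ≤F m
  meetF-exists []      []       []       = [] , nil , []
  meetF-exists (t ∷ f) (p ∷ ps) (q ∷ qs) =
    let u , M , t≤u = meetT-exists t p q
        m , Ms , f≤m = meetF-exists f ps qs
    in u ∷ m , cons M Ms , t≤u ∷ f≤m

IsMeetAbove-ww : ∀ {g f f' h} → IsMeetAbove _≤F_ g f f' h →
  IsMeetAbove _≤T_ (white g) (white f) (white f') (white h)
IsMeetAbove-ww (g≤h , h≤f , h≤f' , greatest) =
  white≤white g≤h , white≤white h≤f , white≤white h≤f' ,
  λ { _ (white≤white g≤c) (white≤white c≤f) (white≤white c≤f') →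
        white≤white (greatest _ g≤c c≤f c≤f') }

IsMeetAbove-bb : ∀ {g f f' h} → IsMeetAbove _≤F_ g f f' h →
  IsMeetAbove _≤T_ (black g) (black f) (black f') (black h)
IsMeetAbove-bb (g≤h , h≤f , h≤f' , greatest) =
  black≤black g≤h , black≤black h≤f , black≤black h≤f' ,
  λ { _ (black≤black g≤c) (black≤black c≤f) (black≤black c≤f') →
        black≤black (greatest _ g≤c c≤f c≤f') }

IsMeetAbove-bb-white : ∀ {g f f' h} → IsMeetAbove _≤F_ (g ++ g) f f' h →
  IsMeetAbove _≤T_ (white g) (black f) (black f') (black h)
IsMeetAbove-bb-white {g} {f} {f'} {h} (gg≤h , h≤f , h≤f' , greatest) =
  ++≤F⇒white≤black g gg≤h , black≤black h≤f , black≤black h≤f' , greatest′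
  where
  greatest′ : ∀ c → white g ≤T c → c ≤T black f → c ≤T black f' → c ≤T black h
  greatest′ (white c) (white≤white g≤c) c≤f c≤f' =
    ++≤F⇒white≤black c (greatest _ (++⁺ g≤c g≤c) (white≤black⇒++≤F c≤f) (white≤black⇒++≤F c≤f'))
  greatest′ (black c) g≤c (black≤black c≤f) (black≤black c≤f') =
    black≤black (greatest c (white≤black⇒++≤F g≤c) c≤f c≤f')

IsMeetAbove-wb : ∀ {g f f' f'' x h} → length f' ≡ length f →
  IsMeetAbove _≤F_ g f f' x → IsMeetAbove _≤F_ g x f'' h →
  IsMeetAbove _≤T_ (white g) (white f) (black (f' ++ f'')) (white h)
IsMeetAbove-wb l (_ , x≤f , x≤f' , greatest₁) (g≤h , h≤x , h≤f'' , greatest₂) =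
  white≤white g≤h , white≤white (≤F-trans h≤x x≤f) , white≤black (≤F-trans h≤x x≤f') h≤f'' ,
  λ { _ (white≤white g≤c) (white≤white c≤f) c≤f'f'' →
        let c≤f' , c≤f'' = Pointwise-++⁻-length _ (trans (Pointwise-length c≤f) (sym l))
                             (white≤black⇒++≤F c≤f'f'')
        in white≤white (greatest₂ _ g≤c (greatest₁ _ g≤c c≤f c≤f') c≤f'') }

mutual
  meetT-isMeet : ∀ {t a b m} → MeetT a b m → t ≤T a → t ≤T b → IsMeetAbove _≤T_ t a b m
  meetT-isMeet (ww M) (white≤white p) (white≤white q) = IsMeetAbove-ww (meetF-isMeet M p q)
  meetT-isMeet (bb M) (black≤black p) (black≤black q) = IsMeetAbove-bb (meetF-isMeet M p q)
  meetT-isMeet (bb M) p@(white≤black _ _) q =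
    IsMeetAbove-bb-white (meetF-isMeet M (white≤black⇒++≤F p) (white≤black⇒++≤F q))
  meetT-isMeet (wb l _ M₁ M₂) (white≤white p) q = wb-isMeet l M₁ M₂ p (white≤black⇒++≤F q)
  meetT-isMeet (bw l _ M₁ M₂) q (white≤white p) =
    IsMeetAbove-sym _≤T_ (wb-isMeet l M₁ M₂ p (white≤black⇒++≤F q))

  wb-isMeet : ∀ {g f f' f'' x h} → length f' ≡ length f → MeetF f f' x → MeetF x f'' h →
    g ≤F f → g ++ g ≤F f' ++ f'' → IsMeetAbove _≤T_ (white g) (white f) (black (f' ++ f'')) (white h)
  wb-isMeet {g} l M₁ M₂ g≤f gg≤f'f'' =
    let g≤f' , g≤f'' = Pointwise-++⁻-length g (trans (Pointwise-length g≤f) (sym l)) gg≤f'f''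
        meet₁ = meetF-isMeet M₁ g≤f g≤f'
    in IsMeetAbove-wb l meet₁ (meetF-isMeet M₂ (proj₁ meet₁) g≤f'')

  meetF-isMeet : ∀ {f a b m} → MeetF a b m → f ≤F a → f ≤F b → IsMeetAbove _≤F_ f a b m
  meetF-isMeet nil         []       []       = IsMeetAbove-[]
  meetF-isMeet (cons M Ms) (p ∷ ps) (q ∷ qs) =
    IsMeetAbove-∷ (meetT-isMeet M p q) (meetF-isMeet Ms ps qs)

JoinF-++ : ∀ {a b j a' b' j'} → JoinF a b j → JoinF a' b' j' → JoinF (a ++ a') (b ++ b') (j ++ j')
JoinF-++ nil         J' = J'
JoinF-++ (cons J Js) J' = cons J (JoinF-++ Js J')

mutual
  joinT-exists : ∀ t {a b} → t ≤T a → t ≤T b → ∃ (JoinT a b)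
  joinT-exists (white g) (white≤white p) (white≤white q) =
    let h , J = joinF-exists g p q in white h , ww J
  joinT-exists (white g) (white≤white p) (white≤black q₁ q₂) =
    let h₁ , J₁ = joinF-exists g p q₁
        h₂ , J₂ = joinF-exists g p q₂
    in black (h₁ ++ h₂) , wb (same-length-above q₁ p) (same-length-above q₂ p) J₁ J₂
  joinT-exists (white g) (white≤black q₁ q₂) (white≤white p) =
    let h₁ , J₁ = joinF-exists g p q₁
        h₂ , J₂ = joinF-exists g p q₂
    in black (h₁ ++ h₂) , bw (same-length-above q₁ p) (same-length-above q₂ p) J₁ J₂
  joinT-exists (white g) (white≤black p₁ p₂) (white≤black q₁ q₂) =
    let h₁ , J₁ = joinF-exists g p₁ q₁
        h₂ , J₂ = joinF-exists g p₂ q₂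
    in black (h₁ ++ h₂) , bb (JoinF-++ J₁ J₂)
  joinT-exists (black g) (black≤black p) (black≤black q) =
    let h , J = joinF-exists g p q in black h , bb J

  joinF-exists : ∀ f {a b} → f ≤F a → f ≤F b → ∃ (JoinF a b)
  joinF-exists []      []       []       = [] , nil
  joinF-exists (t ∷ f) (p ∷ ps) (q ∷ qs) =
    let u , J = joinT-exists t p q
        j , Js = joinF-exists f ps qs
    in u ∷ j , cons J Js

IsJoin-ww : ∀ {f f' h} → IsJoin _≤F_ f f' h → IsJoin _≤T_ (white f) (white f') (white h)
IsJoin-ww {f} {f'} {h} join@(f≤h , f'≤h , least) = white≤white f≤h , white≤white f'≤h , least′
  where
  least′ : ∀ c → white f ≤T c → white f' ≤T c → white h ≤T c
  least′ (white c) (white≤white f≤c) (white≤white f'≤c) = white≤white (least c f≤c f'≤c)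
  least′ (black c) f≤c f'≤c =
    let _ , _ , least₂ = IsJoin-++ join join
    in ++≤F⇒white≤black h (least₂ c (white≤black⇒++≤F f≤c) (white≤black⇒++≤F f'≤c))

IsJoin-bb : ∀ {f f' h} → IsJoin _≤F_ f f' h → IsJoin _≤T_ (black f) (black f') (black h)
IsJoin-bb (f≤h , f'≤h , least) =
  black≤black f≤h , black≤black f'≤h ,
  λ { _ (black≤black f≤c) (black≤black f'≤c) → black≤black (least _ f≤c f'≤c) }

IsJoin-wb : ∀ {f f' h} → IsJoin _≤F_ (f ++ f) f' h → IsJoin _≤T_ (white f) (black f') (black h)
IsJoin-wb {f} (ff≤h , f'≤h , least) =
  ++≤F⇒white≤black f ff≤h , black≤black f'≤h ,
  λ { _ f≤c (black≤black f'≤c) → black≤black (least _ (white≤black⇒++≤F f≤c) f'≤c) }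

mutual
  joinT-isJoin : ∀ {a b j} → JoinT a b j → IsJoin _≤T_ a b j
  joinT-isJoin (ww J)         = IsJoin-ww (joinF-isJoin J)
  joinT-isJoin (bb J)         = IsJoin-bb (joinF-isJoin J)
  joinT-isJoin (wb _ _ J₁ J₂) = IsJoin-wb (IsJoin-++ (joinF-isJoin J₁) (joinF-isJoin J₂))
  joinT-isJoin (bw _ _ J₁ J₂) =
    IsJoin-sym _≤T_ (IsJoin-wb (IsJoin-++ (joinF-isJoin J₁) (joinF-isJoin J₂)))

  joinF-isJoin : ∀ {a b j} → JoinF a b j → IsJoin _≤F_ a b j
  joinF-isJoin nil         = IsJoin-[]
  joinF-isJoin (cons J Js) = IsJoin-∷ (joinT-isJoin J) (joinF-isJoin Js)

IsMeetAbove-≤F⇒IsMeetIn : ∀ {f a b m} → IsMeetAbove _≤F_ f a b m → IsMeetIn f a b m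
IsMeetAbove-≤F⇒IsMeetIn (f≤m , m≤a , m≤b , greatest) =
  ≤F⇒≪ f≤m , ≤F⇒≪ m≤a , ≤F⇒≪ m≤b ,
  λ g f≪g g≪a g≪b → ≤F⇒≪ (greatest g (≪⇒≤F f≪g) (≪⇒≤F g≪a) (≪⇒≤F g≪b))

IsJoin-≤F⇒IsJoinIn : ∀ {f a b j} → f ≤F a → IsJoin _≤F_ a b j → IsJoinIn f a b j
IsJoin-≤F⇒IsJoinIn f≤a (a≤j , b≤j , least) =
  ≤F⇒≪ (≤F-trans f≤a a≤j) , ≤F⇒≪ a≤j , ≤F⇒≪ b≤j ,
  λ g _ a≪g b≪g → ≤F⇒≪ (least g (≪⇒≤F a≪g) (≪⇒≤F b≪g))

proposition2p2p2 : ∀ (f f' f'' : Forest) → f ≪ f' → f ≪ f'' →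
    ((∃ λ m → MeetF f' f'' m) × (∀ m → MeetF f' f'' m → IsMeetIn f f' f'' m))
    × ((∃ λ j → JoinF f' f'' j) × (∀ j → JoinF f' f'' j → IsJoinIn f f' f'' j))
proposition2p2p2 f f' f'' f≪f' f≪f'' =
  ( map₂ proj₁ (meetF-exists f f≤f' f≤f'')
  , λ _ M → IsMeetAbove-≤F⇒IsMeetIn (meetF-isMeet M f≤f' f≤f''))
  , ( joinF-exists f f≤f' f≤f''
    , λ _ J → IsJoin-≤F⇒IsJoinIn f≤f' (joinF-isJoin J))
  where
  f≤f' : f ≤F f'
  f≤f' = ≪⇒≤F f≪f'

  f≤f'' : f ≤F f''
  f≤f'' = ≪⇒≤F f≪f''
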